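{- Let $G$ be a connected graph with at most three triangles. Then $G$ has a connected spanning subgraph $G'$ such that (a) $G'$ contains all the triangles of $G$, and (b) $k(G')=1$.
   Context: All graphs are finite, simple and undirected. A triangle is a cycle of length $3$. The competition graph $C(D)$ of an acyclic digraph $D$ is the graph with vertex set $V(D)$ having an edge between distinct $x,y$ iff there is a vertex $v$ with $(x,v),(y,v)\in A(D)$. The competition number $k(G)$ is the smallest $k\ge0$ such that $G$ together with $k$ new isolated vertices is the competition graph of some acyclic digraph. -}

module Defs where

open import Data.Nat using (ℕ; _+_; _<_; _<ᵇ_)
open import Data.Fin using (Fin; toℕ; splitAt)
open import Data.Bool using (Bool; true; false; _∧_)
open import Data.Sum using (_⊎_; inj₁; inj₂)
open import Data.Product using (Σ; _×_; _,_; ∃)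
open import Data.List using (List; length; filterᵇ; cartesianProduct; allFin)
open import Relation.Binary.PropositionalEquality using (_≡_; _≢_; refl)
open import Relation.Nullary using (¬_)
open import Function.Bundles using (_⇔_)

record Graph (n : ℕ) : Set where
  field
    adj    : Fin n → Fin n → Bool
    sym    : ∀ x y → adj x y ≡ adj y x
    irrefl : ∀ x → adj x x ≡ false

open Graph public

Edge : ∀ {n} → Graph n → Fin n → Fin n → Set
Edge G x y = adj G x y ≡ true

data Walk {n} (G : Graph n) : Fin n → Fin n → Set where
  stay : ∀ {x} → Walk G x x
  step : ∀ {x y z} → Edge G x y → Walk G y z → Walk G x z

Connected : ∀ {n} → Graph n → Set
Connected G = ∀ x y → Walk G x y

-- Triangles: a triangle is the vertex set {a,b,c} of a 3-cycle; we list it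
-- once as the triple with toℕ a < toℕ b < toℕ c.
Triangle : ∀ {n} → Graph n → Fin n → Fin n → Fin n → Set
Triangle G a b c = Edge G a b × Edge G b c × Edge G a c

isTriangleᵇ : ∀ {n} → Graph n → Fin n × Fin n × Fin n → Bool
isTriangleᵇ G (a , b , c) =
  (toℕ a <ᵇ toℕ b) ∧ (toℕ b <ᵇ toℕ c) ∧ adj G a b ∧ adj G b c ∧ adj G a c

triangles : ∀ {n} → Graph n → List (Fin n × Fin n × Fin n)
triangles {n} G =
  filterᵇ (isTriangleᵇ G)
    (cartesianProduct (allFin n) (cartesianProduct (allFin n) (allFin n)))

numTriangles : ∀ {n} → Graph n → ℕ
numTriangles G = length (triangles G)

SpanningSubgraph : ∀ {n} → Graph n → Graph n → Set
SpanningSubgraph {n} G' G = ∀ (x y : Fin n) → Edge G' x y → Edge G x y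

ContainsTrianglesOf : ∀ {n} → Graph n → Graph n → Set
ContainsTrianglesOf {n} G' G =
  ∀ (a b c : Fin n) → Triangle G a b c → Triangle G' a b c

Digraph : ℕ → Set
Digraph m = Fin m → Fin m → Bool

Arc : ∀ {m} → Digraph m → Fin m → Fin m → Set
Arc D x y = D x y ≡ true

data DPath {m} (D : Digraph m) : Fin m → Fin m → Set where
  one  : ∀ {x y} → Arc D x y → DPath D x y
  more : ∀ {x y z} → Arc D x y → DPath D y z → DPath D x z

Acyclic : ∀ {m} → Digraph m → Set
Acyclic D = ∀ x → ¬ DPath D x x

IsCompetitionGraph : ∀ {m} → Digraph m → Graph m → Set
IsCompetitionGraph {m} D H =
  ∀ (x y : Fin m) → x ≢ y →
    (Edge H x y ⇔ ∃ λ (v : Fin m) → Arc D x v × Arc D y v)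

addIsoAdj : ∀ {n} → Graph n → (k : ℕ) → Fin (n + k) → Fin (n + k) → Bool
addIsoAdj {n} G k x y with splitAt n x | splitAt n y
... | inj₁ a | inj₁ b = adj G a b
... | inj₁ _ | inj₂ _ = false
... | inj₂ _ | _      = false

addIsoSym : ∀ {n} (G : Graph n) k x y → addIsoAdj G k x y ≡ addIsoAdj G k y x
addIsoSym {n} G k x y with splitAt n x | splitAt n y
... | inj₁ a | inj₁ b = sym G a b
... | inj₁ _ | inj₂ _ = refl
... | inj₂ _ | inj₁ _ = refl
... | inj₂ _ | inj₂ _ = refl

addIsoIrr : ∀ {n} (G : Graph n) k x → addIsoAdj G k x x ≡ false
addIsoIrr {n} G k x with splitAt n x
... | inj₁ a = irrefl G a
... | inj₂ _ = refl

addIsolated : ∀ {n} → Graph n → (k : ℕ) → Graph (n + k)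
addIsolated G k = record
  { adj = addIsoAdj G k ; sym = addIsoSym G k ; irrefl = addIsoIrr G k }

CompRep : ∀ {n} → Graph n → ℕ → Set
CompRep {n} G k =
  Σ (Digraph (n + k)) λ D → Acyclic D × IsCompetitionGraph D (addIsolated G k)

CompetitionNumber : ∀ {n} → Graph n → ℕ → Set
CompetitionNumber G k = CompRep G k × (∀ j → j < k → ¬ CompRep G j)

module Submission where

-- Order the vertices w₁, …, wₙ by peeling them off one at a time:
-- wᵢ is a vertex of the remaining set Rᵢ = {wᵢ, …, wₙ} whose deletion keeps
-- Rᵢ connected and which lies on at most one triangle inside Rᵢ (`peelable`;
-- it is found among the far vertices of a breadth-first search, using that
-- G has no four pairwise different triangles).  Attach to wᵢ a clique
-- Qᵢ ⊆ Rᵢ: that triangle, or an edge from wᵢ into Rᵢ.  Let the members of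
-- Q₁ point to a new vertex z and those of Qᵢ₊₁ point to wᵢ; arcs go from
-- later to earlier vertices, so the digraph is acyclic (`Assignment`,
-- `assign`).  G' joins the pairs sharing a clique: it is a spanning subgraph
-- of G containing every triangle, connected because each wᵢ is joined to
-- Rᵢ ∖ wᵢ, and G' plus z is the competition graph of the digraph, so
-- k(G') ≤ 1.  Conversely k(G') ≠ 0: the sink of an acyclic digraph is
-- isolated in its competition graph, but G' has no isolated vertex.

open import Defs
open import Data.Bool using (Bool; true; false; T)
import Data.Bool as Bool
open import Data.Bool.Properties using (T-≡; T-∧)
open import Data.Empty using (⊥; ⊥-elim)
open import Data.Fin using (Fin; zero; suc; toℕ; _<_; _↑ˡ_; _↑ʳ_; splitAt)
open import Data.Fin.Patterns using (0F; 1F; 2F; 3F)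
open import Data.Fin.Properties
  using (_≟_; any?; all?; ¬∀⟶∃¬; <-cmp; injective⇒≤; ↑ˡ-injective; pigeonhole;
         splitAt-↑ˡ; splitAt-↑ʳ; splitAt⁻¹-↑ˡ)
open import Data.Fin.Subset using (Subset) renaming (_∈_ to _∈ₛ_; ∣_∣ to ∣_∣ₛ)
open import Data.Fin.Subset.Properties using (p⊂q⇒∣p∣<∣q∣; ∣p∣≤n)
open import Data.List using (List; []; _∷_; length; lookup; allFin; cartesianProduct)
open import Data.List.Membership.Propositional using () renaming (_∈_ to _∈ˡ_)
open import Data.List.Membership.Propositional.Properties using (∈-filter⁺; ∈-cartesianProduct⁺; ∈-allFin)
open import Data.List.Relation.Unary.All using (All; []; _∷_)
import Data.List.Relation.Unary.All as All
open import Data.List.Relation.Unary.Any using (here; there; index)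
import Data.List.Relation.Unary.Any as Any
open import Data.List.Relation.Unary.Any.Properties using (lookup-index)
open import Data.Nat using (ℕ; zero; suc; _+_; _≤_; z≤n; s≤s; _⊔_) renaming (_<_ to _<ℕ_)
import Data.Nat as ℕ
open import Data.Nat.Properties
  using (≤-refl; ≤-trans; <-≤-trans; m≤m⊔n; m≤n⊔m; m≤n⇒m≤1+n; <⇒<ᵇ; ≤-pred; <-irrefl; <-trans;
         n<1+n; ≤∧≢⇒<)
open import Data.Product using (Σ; _×_; _,_; ∃; proj₁; proj₂)
open import Data.Sum using (_⊎_; inj₁; inj₂; swap)
open import Data.Vec using (tabulate)
open import Data.Vec.Properties using (lookup∘tabulate; []=⇒lookup; lookup⇒[]=)
open import Function using (_∘_)
open import Function.Bundles using (Equivalence; mk⇔)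
open import Relation.Binary using (tri<; tri≈; tri>)
open import Relation.Binary.Construct.Closure.ReflexiveTransitive using (Star; ε; _◅_; _◅◅_)
import Relation.Binary.Construct.Closure.ReflexiveTransitive as Star
open import Relation.Binary.PropositionalEquality
  using (_≡_; _≢_; refl; trans; cong; subst; subst₂; ≢-sym) renaming (sym to ≡-sym)
open import Relation.Nullary using (¬_; Dec; yes; no; does; contradiction)
open import Relation.Nullary.Decidable
  using (_×-dec_; _⊎-dec_; _→-dec_; ¬?; dec-true; dec-false; map′; decidable-stable; T?)

does-⇔ : ∀ {p q} {P : Set p} {Q : Set q} (P? : Dec P) (Q? : Dec Q) → (P → Q) → (Q → P) →
  does P? ≡ does Q?
does-⇔ (yes _) (yes _) _ _ = refl
does-⇔ (no _)  (no _)  _ _ = refl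
does-⇔ (yes p) (no ¬q) f _ = contradiction (f p) ¬q
does-⇔ (no ¬p) (yes q) _ g = contradiction (g q) ¬p

does-sound : ∀ {p} {P : Set p} (P? : Dec P) → does P? ≡ true → P
does-sound (yes p) _ = p

uniformStage : ∀ {n p} (P : ℕ → Fin n → Set p) → (∀ {k m x} → k ≤ m → P k x → P m x) →
  (∀ x → ∃ λ k → P k x) → ∃ λ N → ∀ x → P N x
uniformStage {zero} P mono eventually = 0 , λ ()
uniformStage {suc n} P mono eventually
  with eventually zero | uniformStage (λ k x → P k (suc x)) mono (λ x → eventually (suc x))
... | k , P₀ | N , Pₛ = k ⊔ N , λ where
  zero    → mono (m≤m⊔n k N) P₀
  (suc x) → mono (m≤n⊔m k N) (Pₛ x)

lastFailure : ∀ {p} (P : ℕ → Set p) → (∀ k → Dec (P k)) →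
  ∀ N → P N → P 0 ⊎ ∃ λ D → ¬ P D × P (suc D)
lastFailure P P? zero    P₀ = inj₁ P₀
lastFailure P P? (suc N) Pₛ with P? N
... | yes P-N = lastFailure P P? N P-N
... | no ¬P-N = inj₂ (N , ¬P-N , Pₛ)

distinct-members : ∀ {A : Set} {m} (xs : List A) (v : Fin m → A) → (∀ i → v i ∈ˡ xs) →
  (∀ i j → v i ≡ v j → i ≡ j) → m ≤ length xs
distinct-members xs v v∈ v-injective = injective⇒≤ {f = λ i → index (v∈ i)} λ {i} {j} same-index →
  v-injective i j (trans (lookup-index (v∈ i)) (trans (cong (lookup xs) same-index) (≡-sym (lookup-index (v∈ j)))))

_∈ˡ?_ : ∀ {n} (x : Fin n) (Q : List (Fin n)) → Dec (x ∈ˡ Q)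
x ∈ˡ? Q = Any.any? (x ≟_) Q

pattern first  = inj₁ refl
pattern second = inj₂ (inj₁ refl)
pattern third  = inj₂ (inj₂ refl)

-- Sets of vertices are Boolean predicates on Fin n, so that they can be
-- used directly as adjacency and arc relations.
VSet : ℕ → Set
VSet n = Fin n → Bool

-- Membership is wrapped in a record so that Agda can infer the set from a
-- membership proof.
infix 4 _∈_ _∉_
record _∈_ {n} (x : Fin n) (R : VSet n) : Set where
  constructor mem
  field holds : R x ≡ true
open _∈_ public

_∉_ : ∀ {n} → Fin n → VSet n → Set
x ∉ R = ¬ (x ∈ R)

_∈?_ : ∀ {n} (x : Fin n) (R : VSet n) → Dec (x ∈ R)
x ∈? R = map′ mem holds (R x Bool.≟ true)

⟦_⟧ : ∀ {n p} {P : Fin n → Set p} → (∀ x → Dec (P x)) → VSet n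
⟦ P? ⟧ x = does (P? x)

⟦⟧-intro : ∀ {n p} {P : Fin n → Set p} (P? : ∀ x → Dec (P x)) {x} → P x → x ∈ ⟦ P? ⟧
⟦⟧-intro P? {x} Px = mem (dec-true (P? x) Px)

⟦⟧-elim : ∀ {n p} {P : Fin n → Set p} (P? : ∀ x → Dec (P x)) {x} → x ∈ ⟦ P? ⟧ → P x
⟦⟧-elim P? {x} (mem h) = does-sound (P? x) h

-- The set R with the vertex u deleted (opaque: it is only used through the
-- three lemmas below, which also lets Agda infer R and u from memberships).
infixl 5 _∖_
opaque
  _∖_ : ∀ {n} → VSet n → Fin n → VSet n
  R ∖ u = ⟦ (λ x → x ∈? R ×-dec ¬? (x ≟ u)) ⟧

opaque
  unfolding _∖_

  ∖-intro : ∀ {n} {R : VSet n} {u x} → x ∈ R → x ≢ u → x ∈ R ∖ u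
  ∖-intro {R = R} {u} x∈R x≢u = ⟦⟧-intro (λ x → x ∈? R ×-dec ¬? (x ≟ u)) (x∈R , x≢u)

  ∖-⊆ : ∀ {n} {R : VSet n} {u x} → x ∈ R ∖ u → x ∈ R
  ∖-⊆ {R = R} {u} h = proj₁ (⟦⟧-elim (λ x → x ∈? R ×-dec ¬? (x ≟ u)) h)

  ∖-≢ : ∀ {n} {R : VSet n} {u x} → x ∈ R ∖ u → x ≢ u
  ∖-≢ {R = R} {u} h = proj₂ (⟦⟧-elim (λ x → x ∈? R ×-dec ¬? (x ≟ u)) h)

-- The number of vertices of a set, computed through the library's finite
-- subsets so that its monotonicity lemmas apply.
asSubset : ∀ {n} → VSet n → Subset n
asSubset R = tabulate R

∈-asSubset : ∀ {n} {R : VSet n} {x} → x ∈ R → x ∈ₛ asSubset R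
∈-asSubset {R = R} {x} x∈R = lookup⇒[]= x (tabulate R) (trans (lookup∘tabulate R x) (holds x∈R))

asSubset-∈ : ∀ {n} {R : VSet n} {x} → x ∈ₛ asSubset R → x ∈ R
asSubset-∈ {R = R} {x} x∈ = mem (trans (≡-sym (lookup∘tabulate R x)) ([]=⇒lookup x∈))

size : ∀ {n} → VSet n → ℕ
size R = ∣ asSubset R ∣ₛ

size-≤ : ∀ {n} (R : VSet n) → size R ≤ n
size-≤ R = ∣p∣≤n (asSubset R)

-- Deleting a member strictly decreases the size; this drives the recursion
-- that peels the vertices off one by one.
size-∖ : ∀ {n} {R : VSet n} {u} → u ∈ R → size (R ∖ u) <ℕ size R
size-∖ {R = R} {u} u∈R = p⊂q⇒∣p∣<∣q∣
  ( (λ x∈ → ∈-asSubset (∖-⊆ (asSubset-∈ x∈)))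
  , u , ∈-asSubset u∈R , λ u∈ → ∖-≢ (asSubset-∈ u∈) refl )

two-members : ∀ {n} {R : VSet n} {x y} → x ∈ R → y ∈ R → x ≢ y → 2 ≤ size R
two-members x∈R y∈R x≢y = <-≤-trans (s≤s (<-≤-trans (s≤s z≤n) (size-∖ (∖-intro x∈R x≢y)))) (size-∖ y∈R)

module _ {n : ℕ} (G : Graph n) where

  edge-sym : ∀ {x y} → Edge G x y → Edge G y x
  edge-sym {x} {y} e = trans (sym G y x) e

  edge-≢ : ∀ {x y} → Edge G x y → x ≢ y
  edge-≢ {x} e refl with trans (≡-sym e) (irrefl G x)
  ... | ()

  edge-≢′ : ∀ {x y} → Edge G x y → y ≢ x
  edge-≢′ e = ≢-sym (edge-≢ e)

  Edge? : ∀ x y → Dec (Edge G x y)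
  Edge? x y = adj G x y Bool.≟ true

  data WalkIn (R : VSet n) : Fin n → Fin n → Set where
    stayIn : ∀ {x} → x ∈ R → WalkIn R x x
    stepIn : ∀ {x y z} → x ∈ R → Edge G x y → WalkIn R y z → WalkIn R x z

  ConnectedAt : VSet n → Fin n → Set
  ConnectedAt R ρ = ∀ x → x ∈ R → WalkIn R x ρ

  module _ {R : VSet n} where

    walk-start : ∀ {x y} → WalkIn R x y → x ∈ R
    walk-start (stayIn x∈R)     = x∈R
    walk-start (stepIn x∈R _ _) = x∈R

    walk-++ : ∀ {x y z} → WalkIn R x y → WalkIn R y z → WalkIn R x z
    walk-++ (stayIn _)       w = w
    walk-++ (stepIn x∈R e v) w = stepIn x∈R e (walk-++ v w)

    walk-reverse : ∀ {x y} → WalkIn R x y → WalkIn R y x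
    walk-reverse (stayIn x∈R)     = stayIn x∈R
    walk-reverse (stepIn x∈R e w) =
      walk-++ (walk-reverse w) (stepIn (walk-start w) (edge-sym e) (stayIn x∈R))

    reroot : ∀ {ρ ρ'} → ConnectedAt R ρ → ρ' ∈ R → ConnectedAt R ρ'
    reroot conn ρ'∈R x x∈R = walk-++ (conn x x∈R) (walk-reverse (conn _ ρ'∈R))

  Dominates : VSet n → Fin n → Set
  Dominates R u = ∀ y → y ∈ R → y ≡ u ⊎ Edge G y u

  record FarVertex (R : VSet n) (ρ : Fin n) : Set where
    field
      far        : Fin n
      far∈R      : far ∈ R
      far≢ρ      : far ≢ ρ
      deletable  : ConnectedAt (R ∖ far) ρ
      dominating : Edge G far ρ → Dominates R ρ

  module _ (R : VSet n) (ρ : Fin n) (ρ∈R : ρ ∈ R) where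

    NearStep : VSet n → Fin n → Set
    NearStep B y = y ∈ B ⊎ (y ∈ R × ∃ λ z → z ∈ B × Edge G y z)

    -- ball k: the vertices joined to ρ by a walk inside R of length ≤ k
    -- (opaque, used only through the four lemmas below).
    opaque
      ball : ℕ → VSet n
      ball zero    = ⟦ (_≟ ρ) ⟧
      ball (suc k) = ⟦ (λ y → y ∈? ball k ⊎-dec (y ∈? R ×-dec any? λ z → z ∈? ball k ×-dec Edge? y z)) ⟧

    opaque
      unfolding ball

      ball-zero⁺ : ρ ∈ ball 0
      ball-zero⁺ = ⟦⟧-intro (_≟ ρ) refl

      ball-zero⁻ : ∀ {y} → y ∈ ball 0 → y ≡ ρ
      ball-zero⁻ = ⟦⟧-elim (_≟ ρ)

      ball-suc⁺ : ∀ k {y} → NearStep (ball k) y → y ∈ ball (suc k)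
      ball-suc⁺ k = ⟦⟧-intro (λ y → y ∈? ball k ⊎-dec (y ∈? R ×-dec any? λ z → z ∈? ball k ×-dec Edge? y z))

      ball-suc⁻ : ∀ k {y} → y ∈ ball (suc k) → NearStep (ball k) y
      ball-suc⁻ k = ⟦⟧-elim (λ y → y ∈? ball k ⊎-dec (y ∈? R ×-dec any? λ z → z ∈? ball k ×-dec Edge? y z))

    ball-mono : ∀ {k m y} → k ≤ m → y ∈ ball k → y ∈ ball m
    ball-mono {zero}  {zero}  _ y∈ = y∈
    ball-mono {zero}  {suc m} _ y∈ = ball-suc⁺ m (inj₁ (ball-mono {zero} {m} z≤n y∈))
    ball-mono {suc k} {suc m} (s≤s k≤m) y∈ with ball-suc⁻ k y∈
    ... | inj₁ y∈ball = ball-suc⁺ m (inj₁ (ball-mono k≤m y∈ball))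
    ... | inj₂ (y∈R , z , z∈ball , e) = ball-suc⁺ m (inj₂ (y∈R , z , ball-mono k≤m z∈ball , e))

    ball-grows : ∀ {k y} → y ∈ ball k → y ∈ ball (suc k)
    ball-grows {k} y∈ = ball-suc⁺ k (inj₁ y∈)

    root∈ball : ∀ k → ρ ∈ ball k
    root∈ball k = ball-mono {zero} z≤n ball-zero⁺

    walk⇒ball : ∀ {y} → WalkIn R y ρ → ∃ λ k → y ∈ ball k
    walk⇒ball (stayIn _) = 0 , root∈ball 0
    walk⇒ball (stepIn y∈R e w) with walk⇒ball w
    ... | k , z∈ball = suc k , ball-suc⁺ k (inj₂ (y∈R , _ , z∈ball , e))

    ball-avoids : ∀ {u} k → u ∉ ball k → ∀ {y} → y ∈ ball k → WalkIn (R ∖ u) y ρ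
    ball-avoids zero u∉ y∈ rewrite ball-zero⁻ y∈ =
      stayIn (∖-intro ρ∈R λ { refl → u∉ (root∈ball 0) })
    ball-avoids (suc k) u∉ y∈ with ball-suc⁻ k y∈
    ... | inj₁ y∈ball = ball-avoids k (u∉ ∘ ball-grows) y∈ball
    ... | inj₂ (y∈R , z , z∈ball , e) =
      stepIn (∖-intro y∈R λ { refl → u∉ y∈ }) e (ball-avoids k (u∉ ∘ ball-grows) z∈ball)

    Covers : ℕ → Set
    Covers k = ∀ y → y ∈ R → y ∈ ball k

    Covers? : ∀ k → Dec (Covers k)
    Covers? k = all? λ y → y ∈? R →-dec y ∈? ball k

    eventually-covers : ConnectedAt R ρ → ∃ Covers
    eventually-covers conn =
      uniformStage (λ k y → y ∈ R → y ∈ ball k) (λ k≤m in-k y∈R → ball-mono k≤m (in-k y∈R)) reached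
      where
      reached : ∀ y → ∃ λ k → y ∈ R → y ∈ ball k
      reached y with y ∈? R
      ... | yes y∈R = let (k , y∈) = walk⇒ball (conn y y∈R) in k , λ _ → y∈
      ... | no y∉R  = 0 , λ y∈R → ⊥-elim (y∉R y∈R)

    -- If ball D misses a vertex u of R but ball (D + 1) covers R, then u is
    -- far: every other vertex reaches ρ through ball D, which avoids u.  If
    -- u is adjacent to ρ then u ∈ ball 1, so D = 0 and ρ dominates R.
    far-beyond : ∀ D → ¬ Covers D → Covers (suc D) → FarVertex R ρ
    far-beyond D ¬coversD coversD+1
      with ¬∀⟶∃¬ n (λ y → y ∈ R → y ∈ ball D) (λ y → y ∈? R →-dec y ∈? ball D) ¬coversD
    ... | u , ¬u∈ball with u ∈? R | u ∈? ball D
    ... | no u∉R  | _         = ⊥-elim (¬u∈ball (λ u∈R → ⊥-elim (u∉R u∈R)))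
    ... | yes _   | yes u∈    = ⊥-elim (¬u∈ball (λ _ → u∈))
    ... | yes u∈R | no u∉ball = record
      { far        = u
      ; far∈R      = u∈R
      ; far≢ρ      = λ { refl → u∉ball (root∈ball D) }
      ; deletable  = deletable
      ; dominating = dominating D u∉ball coversD+1
      }
      where
      deletable : ConnectedAt (R ∖ u) ρ
      deletable y y∈R∖u with ball-suc⁻ D (coversD+1 y (∖-⊆ y∈R∖u))
      ... | inj₁ y∈ball = ball-avoids D u∉ball y∈ball
      ... | inj₂ (_ , z , z∈ball , e) = stepIn y∈R∖u e (ball-avoids D u∉ball z∈ball)

      dominating : ∀ D → u ∉ ball D → Covers (suc D) → Edge G u ρ → Dominates R ρ
      dominating (suc D) u∉ _ e _ _ =
        ⊥-elim (u∉ (ball-mono (s≤s z≤n) (ball-suc⁺ 0 (inj₂ (u∈R , ρ , root∈ball 0 , e)))))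
      dominating zero _ covers₁ _ y y∈R with ball-suc⁻ 0 (covers₁ y y∈R)
      ... | inj₁ y∈ball = inj₁ (ball-zero⁻ y∈ball)
      ... | inj₂ (_ , z , z∈ball , e) rewrite ball-zero⁻ z∈ball = inj₂ e

    -- A connected set with a second vertex x ≠ ρ has a far vertex: take the
    -- last radius whose ball does not cover R (ball 0 = {ρ} does not).
    farthest : ConnectedAt R ρ → ∀ {x} → x ∈ R → x ≢ ρ → FarVertex R ρ
    farthest conn {x} x∈R x≢ρ with eventually-covers conn
    ... | N , covers with lastFailure Covers Covers? N covers
    ... | inj₁ covers₀ = ⊥-elim (x≢ρ (ball-zero⁻ (covers₀ x x∈R)))
    ... | inj₂ (D , ¬coversD , coversD+1) = far-beyond D ¬coversD coversD+1

  Triple : Set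
  Triple = Fin n × Fin n × Fin n

  infix 4 _∈₃_
  _∈₃_ : Fin n → Triple → Set
  v ∈₃ (a , b , c) = v ≡ a ⊎ v ≡ b ⊎ v ≡ c

  record Tri : Set where
    constructor tri
    field
      a b c : Fin n
      triangle : Triangle G a b c

  corners : Tri → Triple
  corners (tri a b c _) = a , b , c

  Separated : Tri → Tri → Set
  Separated t t' = ∃ λ v → v ∈₃ corners t × ¬ (v ∈₃ corners t')

  Different : Tri → Tri → Set
  Different t t' = Separated t t' ⊎ Separated t' t

  ∈₃-⊆ : ∀ {a b c s} → a ∈₃ s → b ∈₃ s → c ∈₃ s → ∀ v → v ∈₃ (a , b , c) → v ∈₃ s
  ∈₃-⊆ a∈ _  _  _ first  = a∈
  ∈₃-⊆ _  b∈ _  _ second = b∈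
  ∈₃-⊆ _  _  c∈ _ third  = c∈

  Listing : Tri → Set
  Listing t = Σ Triple λ s → s ∈ˡ triangles G ×
    (∀ v → v ∈₃ corners t → v ∈₃ s) × (∀ v → v ∈₃ s → v ∈₃ corners t)

  listed-sorted : ∀ t {a b c} → a < b → b < c → Triangle G a b c →
    a ∈₃ corners t → b ∈₃ corners t → c ∈₃ corners t →
    let (x , y , z) = corners t in x ∈₃ (a , b , c) → y ∈₃ (a , b , c) → z ∈₃ (a , b , c) →
    Listing t
  listed-sorted t {a} {b} {c} a<b b<c (ab , bc , ac) a∈ b∈ c∈ x∈ y∈ z∈ =
    (a , b , c) , ∈-filter⁺ (T? ∘ isTriangleᵇ G) every-triple sorted-triangle ,
    ∈₃-⊆ x∈ y∈ z∈ , ∈₃-⊆ a∈ b∈ c∈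
    where
    every-triple : (a , b , c) ∈ˡ cartesianProduct (allFin n) (cartesianProduct (allFin n) (allFin n))
    every-triple = ∈-cartesianProduct⁺ (∈-allFin a) (∈-cartesianProduct⁺ (∈-allFin b) (∈-allFin c))
    sorted-triangle : T (isTriangleᵇ G (a , b , c))
    sorted-triangle = T-∧⁺ (<⇒<ᵇ a<b) (T-∧⁺ (<⇒<ᵇ b<c) (T-∧⁺ (T⁺ ab) (T-∧⁺ (T⁺ bc) (T⁺ ac))))
      where
      T⁺ : ∀ {x} → x ≡ true → T x
      T⁺ = Equivalence.from T-≡
      T-∧⁺ : ∀ {x y} → T x → T y → T (x Bool.∧ y)
      T-∧⁺ Tx Ty = Equivalence.from T-∧ (Tx , Ty)

  listed : ∀ t → Listing t
  listed t@(tri x y z (xy , yz , xz)) with <-cmp x y | <-cmp y z | <-cmp x z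
  ... | tri≈ _ x≡y _ | _ | _ = ⊥-elim (edge-≢ xy x≡y)
  ... | _ | tri≈ _ y≡z _ | _ = ⊥-elim (edge-≢ yz y≡z)
  ... | _ | _ | tri≈ _ x≡z _ = ⊥-elim (edge-≢ xz x≡z)
  ... | tri< x<y _ _ | tri< y<z _ _ | _ =
    listed-sorted t x<y y<z (xy , yz , xz) first second third first second third
  ... | tri< x<y _ _ | tri> _ _ z<y | tri< x<z _ _ =
    listed-sorted t x<z z<y (xz , edge-sym yz , xy) first third second first third second
  ... | tri< x<y _ _ | tri> _ _ z<y | tri> _ _ z<x =
    listed-sorted t z<x x<y (edge-sym xz , xy , edge-sym yz) third first second second third first
  ... | tri> _ _ y<x | tri< y<z _ _ | tri< x<z _ _ =
    listed-sorted t y<x x<z (edge-sym xy , xz , yz) second first third second first third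
  ... | tri> _ _ y<x | tri< y<z _ _ | tri> _ _ z<x =
    listed-sorted t y<z z<x (yz , edge-sym xz , edge-sym xy) second third first third first second
  ... | tri> _ _ y<x | tri> _ _ z<y | _ =
    listed-sorted t z<y y<x (edge-sym yz , edge-sym xy , edge-sym xz) third second first third second first

  listed-injective : ∀ t t' → Different t t' → proj₁ (listed t) ≢ proj₁ (listed t')
  listed-injective t t' different same with listed t | listed t'
  listed-injective t t' (inj₁ (v , v∈t , v∉t')) refl | s , _ , t⊆s , _ | .s , _ , _ , s⊆t' =
    v∉t' (s⊆t' v (t⊆s v v∈t))
  listed-injective t t' (inj₂ (v , v∈t' , v∉t)) refl | s , _ , _ , s⊆t | .s , _ , t'⊆s , _ =
    v∉t (s⊆t v (t'⊆s v v∈t'))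

  different-triangles : ∀ {m} (t : Fin m → Tri) → (∀ i j → i ≢ j → Different (t i) (t j)) →
    m ≤ numTriangles G
  different-triangles t apart =
    distinct-members (triangles G) (λ i → proj₁ (listed (t i))) (λ i → proj₁ (proj₂ (listed (t i))))
      λ i j same → decidable-stable (i ≟ j) λ i≢j → listed-injective (t i) (t j) (apart i j i≢j) same

  four-triangles : ∀ t₀ t₁ t₂ t₃ → Different t₀ t₁ → Different t₀ t₂ → Different t₀ t₃ →
    Different t₁ t₂ → Different t₁ t₃ → Different t₂ t₃ → 4 ≤ numTriangles G
  four-triangles t₀ t₁ t₂ t₃ d₀₁ d₀₂ d₀₃ d₁₂ d₁₃ d₂₃ = different-triangles t apart
    where
    t : Fin 4 → Tri
    t 0F = t₀
    t 1F = t₁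
    t 2F = t₂
    t 3F = t₃
    apart : ∀ i j → i ≢ j → Different (t i) (t j)
    apart 0F 1F _ = d₀₁
    apart 0F 2F _ = d₀₂
    apart 0F 3F _ = d₀₃
    apart 1F 2F _ = d₁₂
    apart 1F 3F _ = d₁₃
    apart 2F 3F _ = d₂₃
    apart 1F 0F _ = swap d₀₁
    apart 2F 0F _ = swap d₀₂
    apart 3F 0F _ = swap d₀₃
    apart 2F 1F _ = swap d₁₂
    apart 3F 1F _ = swap d₁₃
    apart 3F 2F _ = swap d₂₃
    apart 0F 0F i≢i = ⊥-elim (i≢i refl)
    apart 1F 1F i≢i = ⊥-elim (i≢i refl)
    apart 2F 2F i≢i = ⊥-elim (i≢i refl)
    apart 3F 3F i≢i = ⊥-elim (i≢i refl)

  IsClique : List (Fin n) → Set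
  IsClique Q = ∀ {a b} → a ∈ˡ Q → b ∈ˡ Q → a ≢ b → Edge G a b

  clique-[] : IsClique []
  clique-[] ()

  clique-∷ : ∀ {x xs} → All (Edge G x) xs → IsClique xs → IsClique (x ∷ xs)
  clique-∷ _   _  (here refl) (here refl) x≢x = ⊥-elim (x≢x refl)
  clique-∷ x~  _  (here refl) (there b∈)  _   = All.lookup x~ b∈
  clique-∷ x~  _  (there a∈)  (here refl) _   = edge-sym (All.lookup x~ a∈)
  clique-∷ _   xs (there a∈)  (there b∈)  a≢b = xs a∈ b∈ a≢b

  neighbour : ∀ {R r w} → ConnectedAt R r → w ≢ r → w ∈ R → ∃ λ v → v ∈ R × Edge G w v
  neighbour {w = w} conn w≢r w∈R with conn w w∈R
  ... | stayIn _       = ⊥-elim (w≢r refl)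
  ... | stepIn _ e walk = _ , walk-start walk , e

  dominated-deletable : ∀ {R u} → u ∈ R → Dominates R u → ∀ {y} → y ≢ u → ConnectedAt (R ∖ y) u
  dominated-deletable {R} {u} u∈R dom {y} y≢u v v∈R∖y with dom v (∖-⊆ v∈R∖y)
  ... | inj₁ refl = stayIn v∈R∖y
  ... | inj₂ e    = stepIn v∈R∖y e (stayIn (∖-intro u∈R λ { refl → y≢u refl }))

  TriangleAt : VSet n → Fin n → Fin n → Fin n → Set
  TriangleAt R w a b = a ∈ R × b ∈ R × Triangle G w a b

  TriangleAt? : ∀ R w a b → Dec (TriangleAt R w a b)
  TriangleAt? R w a b = a ∈? R ×-dec b ∈? R ×-dec Edge? w a ×-dec Edge? a b ×-dec Edge? w b

  TriangleAt-swap : ∀ {R w a b} → TriangleAt R w a b → TriangleAt R w b a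
  TriangleAt-swap (a∈ , b∈ , wa , ab , wb) = b∈ , a∈ , wb , edge-sym ab , wa

  asTri : ∀ {R w a b} → TriangleAt R w a b → Tri
  asTri {w = w} {a} {b} (_ , _ , t) = tri w a b t

  TwoTrianglesAt : VSet n → Fin n → Set
  TwoTrianglesAt R w = ∃ λ a → ∃ λ b → ∃ λ c → ∃ λ d →
    TriangleAt R w a b × TriangleAt R w c d × c ≢ a × c ≢ b

  TwoTrianglesAt? : ∀ R w → Dec (TwoTrianglesAt R w)
  TwoTrianglesAt? R w = any? λ a → any? λ b → any? λ c → any? λ d →
    TriangleAt? R w a b ×-dec TriangleAt? R w c d ×-dec ¬? (c ≟ a) ×-dec ¬? (c ≟ b)

  ∉₃ : ∀ {v a b c} → v ≢ a → v ≢ b → v ≢ c → ¬ (v ∈₃ (a , b , c))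
  ∉₃ v≢a _   _   (inj₁ v≡a)        = v≢a v≡a
  ∉₃ _   v≢b _   (inj₂ (inj₁ v≡b)) = v≢b v≡b
  ∉₃ _   _   v≢c (inj₂ (inj₂ v≡c)) = v≢c v≡c

  module _ (few : numTriangles G ≤ 3) where

    no-four : 4 ≤ numTriangles G → ⊥
    no-four four with ≤-trans four few
    ... | s≤s (s≤s (s≤s ()))

    second-differs : ∀ {R w a b c d} (t : TriangleAt R w a b) (t' : TriangleAt R w c d) →
      c ≢ a → c ≢ b → Separated (asTri t') (asTri t)
    second-differs (_ , _ , _ , _ , _) (_ , _ , wc , _ , _) c≢a c≢b =
      _ , second , ∉₃ (edge-≢′ wc) c≢a c≢b

    misses : ∀ {R y y' a b} → y ≢ y' → ¬ Edge G y y' → (t : TriangleAt R y' a b) →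
      ¬ (y ∈₃ corners (asTri t))
    misses y≢y' y≁y' (_ , _ , y'a , _ , y'b) =
      ∉₃ y≢y' (λ { refl → y≁y' (edge-sym y'a) }) (λ { refl → y≁y' (edge-sym y'b) })

    -- Two non-adjacent vertices cannot both lie on two triangles: the four
    -- triangles would be pairwise different.
    not-both-on-two : ∀ {R R' y y'} → y ≢ y' → ¬ Edge G y y' →
      TwoTrianglesAt R y → TwoTrianglesAt R' y' → ⊥
    not-both-on-two y≢y' y≁y' (_ , _ , _ , _ , t₀ , t₁ , c≢a , c≢b) (_ , _ , _ , _ , t₂ , t₃ , c'≢a' , c'≢b') =
      no-four (four-triangles (asTri t₀) (asTri t₁) (asTri t₂) (asTri t₃)
        (inj₂ (second-differs t₀ t₁ c≢a c≢b))
        (inj₁ (_ , first , misses y≢y' y≁y' t₂)) (inj₁ (_ , first , misses y≢y' y≁y' t₃))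
        (inj₁ (_ , first , misses y≢y' y≁y' t₂)) (inj₁ (_ , first , misses y≢y' y≁y' t₃))
        (inj₂ (second-differs t₂ t₃ c'≢a' c'≢b')))

    Complete : VSet n → Set
    Complete R = ∀ y y' → y ∈ R → y' ∈ R → y ≢ y' → Edge G y y'

    -- A vertex on two triangles of a complete set spans a K₄, which has four
    -- triangles.
    not-two-in-complete : ∀ {R u} → Complete R → ¬ TwoTrianglesAt R u
    not-two-in-complete {R} {u} complete (a , b , c , _ , (a∈ , b∈ , ua , ab , ub) , (c∈ , _ , uc , _) , c≢a , c≢b) =
      no-four (four-triangles uab uac ubc abc
        (inj₁ (b , third , ∉₃ (edge-≢′ ub) (edge-≢′ ab) (≢-sym c≢b)))
        (inj₁ (a , second , ∉₃ (edge-≢′ ua) (edge-≢ ab) (≢-sym c≢a)))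
        (inj₁ (u , first , ∉₃ (edge-≢ ua) (edge-≢ ub) (edge-≢ uc)))
        (inj₁ (a , second , ∉₃ (edge-≢′ ua) (edge-≢ ab) (≢-sym c≢a)))
        (inj₁ (u , first , ∉₃ (edge-≢ ua) (edge-≢ ub) (edge-≢ uc)))
        (inj₁ (u , first , ∉₃ (edge-≢ ua) (edge-≢ ub) (edge-≢ uc))))
      where
      ac : Edge G a c
      ac = complete a c a∈ c∈ (≢-sym c≢a)
      bc : Edge G b c
      bc = complete b c b∈ c∈ (≢-sym c≢b)
      uab uac ubc abc : Tri
      uab = tri u a b (ua , ab , ub)
      uac = tri u a c (ua , ac , uc)
      ubc = tri u b c (ub , bc , uc)
      abc = tri a b c (ab , bc , ac)

    record Peel (R : VSet n) : Set where
      field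
        w         : Fin n
        w∈R       : w ∈ R
        root      : Fin n
        root∈     : root ∈ R ∖ w
        remains   : ConnectedAt (R ∖ w) root
        partner   : Fin n
        others    : List (Fin n)
        partner≢w : partner ≢ w
        clique    : IsClique (w ∷ partner ∷ others)
        clique⊆R  : All (_∈ R) (w ∷ partner ∷ others)
        covers    : ∀ {a b} → TriangleAt R w a b → a ∈ˡ w ∷ partner ∷ others × b ∈ˡ w ∷ partner ∷ others

    -- A deletable vertex on at most one triangle of R is peelable: take as
    -- clique that triangle, or an edge at w if there is none.
    peel-at : ∀ {R w v root} → w ∈ R → ¬ TwoTrianglesAt R w → v ∈ R → Edge G w v →
      root ∈ R ∖ w → ConnectedAt (R ∖ w) root → Peel R
    peel-at {R} {w} {v} {root} w∈R on-one v∈R wv root∈ remains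
      with any? (λ a → any? λ b → TriangleAt? R w a b)
    ... | no none = record
      { w = w ; w∈R = w∈R ; root = root ; root∈ = root∈ ; remains = remains
      ; partner = v ; others = [] ; partner≢w = edge-≢′ wv
      ; clique = clique-∷ (wv ∷ []) (clique-∷ [] clique-[])
      ; clique⊆R = w∈R ∷ v∈R ∷ []
      ; covers = λ {a} {b} t → ⊥-elim (none (a , b , t))
      }
    ... | yes (a , b , t@(a∈ , b∈ , wa , ab , wb)) = record
      { w = w ; w∈R = w∈R ; root = root ; root∈ = root∈ ; remains = remains
      ; partner = a ; others = b ∷ [] ; partner≢w = edge-≢′ wa
      ; clique = clique-∷ (wa ∷ wb ∷ []) (clique-∷ (ab ∷ []) (clique-∷ [] clique-[]))
      ; clique⊆R = w∈R ∷ a∈ ∷ b∈ ∷ []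
      ; covers = λ t' → on-t t' , on-t (TriangleAt-swap t')
      }
      where
      -- any other triangle at w shares its corners with t
      on-t : ∀ {p q} → TriangleAt R w p q → p ∈ˡ w ∷ a ∷ b ∷ []
      on-t {p} {q} t' with p ≟ a | p ≟ b
      ... | yes refl | _        = there (here refl)
      ... | no _     | yes refl = there (there (here refl))
      ... | no p≢a   | no p≢b   = ⊥-elim (on-one (a , b , p , q , t , t' , p≢a , p≢b))

    peel-far : ∀ {R ρ} → ρ ∈ R → ConnectedAt R ρ → (F : FarVertex R ρ) →
      ¬ TwoTrianglesAt R (FarVertex.far F) → Peel R
    peel-far ρ∈R conn F on-one =
      let (v , v∈R , e) = neighbour conn far≢ρ far∈R
      in peel-at far∈R on-one v∈R e (∖-intro ρ∈R (≢-sym far≢ρ)) deletable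
      where open FarVertex F

    not-dominating : ∀ {R u y y'} → Dominates R u → y' ∈ R → y ≢ y' → ¬ Edge G y y' → y ≢ u
    not-dominating dom y'∈R y≢y' y≁y' refl with dom _ y'∈R
    ... | inj₁ y'≡y = y≢y' (≡-sym y'≡y)
    ... | inj₂ e    = y≁y' (edge-sym e)

    -- Beside a dominating vertex u, any vertex on at most one triangle is
    -- peelable: u keeps the rest connected.
    peel-beside : ∀ {R u y} → u ∈ R → Dominates R u → y ∈ R → y ≢ u → ¬ TwoTrianglesAt R y → Peel R
    peel-beside {R} {u} u∈R dom y∈R y≢u on-one with dom _ y∈R
    ... | inj₁ y≡u = ⊥-elim (y≢u y≡u)
    ... | inj₂ yu  = peel-at y∈R on-one u∈R yu (∖-intro u∈R (≢-sym y≢u)) (dominated-deletable u∈R dom y≢u)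

    -- A dominating vertex on two triangles forces R to be incomplete, and of
    -- two non-adjacent vertices one lies on at most one triangle.
    peel-dominated : ∀ {R u} → u ∈ R → Dominates R u → TwoTrianglesAt R u → Peel R
    peel-dominated {R} {u} u∈R dom two
      with any? (λ y → any? λ y' → y ∈? R ×-dec y' ∈? R ×-dec ¬? (y ≟ y') ×-dec ¬? (Edge? y y'))
    ... | no complete = ⊥-elim (not-two-in-complete (λ y y' y∈R y'∈R y≢y' →
            decidable-stable (Edge? y y') λ y≁y' → complete (y , y' , y∈R , y'∈R , y≢y' , y≁y')) two)
    ... | yes (y , y' , y∈R , y'∈R , y≢y' , y≁y') with TwoTrianglesAt? R y | TwoTrianglesAt? R y'
    ... | no on-one-y  | _ = peel-beside u∈R dom y∈R (not-dominating dom y'∈R y≢y' y≁y') on-one-y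
    ... | yes _ | no on-one-y' =
      peel-beside u∈R dom y'∈R (not-dominating dom y∈R (≢-sym y≢y') (y≁y' ∘ edge-sym)) on-one-y'
    ... | yes two-y | yes two-y' = ⊥-elim (not-both-on-two y≢y' y≁y' two-y two-y')

    -- Let u be far from ρ and u' far from u; if both lie on two
    -- triangles, they are adjacent (otherwise there would be four triangles), so u
    -- dominates R.
    peelable : ∀ {R ρ} → ρ ∈ R → ConnectedAt R ρ → ∀ {x} → x ∈ R → x ≢ ρ → Peel R
    peelable {R} {ρ} ρ∈R conn {x} x∈R x≢ρ = from-u (TwoTrianglesAt? R u)
      where
      F : FarVertex R ρ
      F = farthest R ρ ρ∈R conn x∈R x≢ρ
      open FarVertex F using () renaming (far to u; far∈R to u∈R; far≢ρ to u≢ρ)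
      F' : FarVertex R u
      F' = farthest R u u∈R (reroot conn u∈R) ρ∈R (≢-sym u≢ρ)
      open FarVertex F' using () renaming (far to u'; far≢ρ to u'≢u; dominating to dominates-if-near)

      from-u' : TwoTrianglesAt R u → Dec (TwoTrianglesAt R u') → Peel R
      from-u' _ (no on-one-u') = peel-far u∈R (reroot conn u∈R) F' on-one-u'
      from-u' two-u (yes two-u') with Edge? u' u
      ... | yes u'u  = peel-dominated u∈R (dominates-if-near u'u) two-u
      ... | no u'≁u = ⊥-elim (not-both-on-two u'≢u u'≁u two-u' two-u)

      from-u : Dec (TwoTrianglesAt R u) → Peel R
      from-u (no on-one-u)  = peel-far ρ∈R conn F on-one-u
      from-u (yes two-u) = from-u' two-u (TwoTrianglesAt? R u')

    -- Sinks: the vertices of G followed by one new vertex.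
    Sink : Set
    Sink = Fin (n + 1)

    ι : Fin n → Sink
    ι a = a ↑ˡ 1

    Linked : (Sink → VSet n) → Fin n → Fin n → Set
    Linked K x y = ∃ λ q → x ∈ K q × y ∈ K q

    linked-sym : ∀ {K x y} → Linked K x y → Linked K y x
    linked-sym (q , x∈ , y∈) = q , y∈ , x∈

    -- K q is a clique of G inside R (later: the in-neighbours of sink q);
    -- every member of K (ι y) lies strictly below y, so arcs x → q climb;
    -- the cliques connect R and contain every triangle of G inside R.
    record Assignment (R : VSet n) (p : Sink) (k : ℕ) : Set where
      field
        K           : Sink → VSet n
        height      : Fin n → ℕ
        K⊆R         : ∀ {q x} → x ∈ K q → x ∈ R
        climbs      : ∀ {q x} → x ∈ K q → q ≡ p ⊎ ∃ λ y → q ≡ ι y × y ∈ R × height x <ℕ height y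
        height≤     : ∀ {x} → x ∈ R → height x ≤ k
        K-clique    : ∀ {q a b} → a ∈ K q → b ∈ K q → a ≢ b → Edge G a b
        K-connects  : ∀ {x y} → x ∈ R → y ∈ R → Star (Linked K) x y
        K-triangles : ∀ {a b c} → a ∈ R → b ∈ R → c ∈ R → Triangle G a b c →
                      Linked K a b × Linked K b c × Linked K a c

    assign-single : ∀ {R ρ p k} → (∀ {x} → x ∈ R → x ≡ ρ) → Assignment R p k
    assign-single {R} {ρ} only-ρ = record
      { K = λ _ _ → false ; height = λ _ → 0
      ; K⊆R = λ () ; climbs = λ () ; height≤ = λ _ → z≤n ; K-clique = λ ()
      ; K-connects = λ x∈ y∈ → subst₂ (Star _) (≡-sym (only-ρ x∈)) (≡-sym (only-ρ y∈)) ε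
      ; K-triangles = λ a∈ b∈ _ (ab , _) → ⊥-elim (edge-≢ ab (trans (only-ρ a∈) (≡-sym (only-ρ b∈))))
      }

    -- Peeling w off R: the clique of w goes to the top sink p, and the
    -- assignment of R ∖ w (with top sink ι w) is kept below w.
    assign-peel : ∀ {R p k} → (∀ {y} → y ∈ R → ι y ≢ p) → (pl : Peel R) →
      Assignment (R ∖ Peel.w pl) (ι (Peel.w pl)) k → Assignment R p (suc k)
    assign-peel {R} {p} {k} fresh pl A = record
      { K = K ; height = height ; K⊆R = K⊆R ; climbs = climbs ; height≤ = height≤
      ; K-clique = K-clique ; K-connects = K-connects ; K-triangles = K-triangles }
      where
      open Peel pl
      module A = Assignment A
      Q : List (Fin n)
      Q = w ∷ partner ∷ others

      K-dec : ∀ q x → Dec ((q ≡ p × x ∈ˡ Q) ⊎ x ∈ A.K q)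
      K-dec q x = (q ≟ p ×-dec x ∈ˡ? Q) ⊎-dec x ∈? A.K q

      K : Sink → VSet n
      K q = ⟦ K-dec q ⟧

      top : ∀ {x} → x ∈ˡ Q → x ∈ K p
      top x∈Q = ⟦⟧-intro (K-dec p) (inj₁ (refl , x∈Q))

      old : ∀ {q x} → x ∈ A.K q → x ∈ K q
      old {q} x∈ = ⟦⟧-intro (K-dec q) (inj₂ x∈)

      height : Fin n → ℕ
      height x with x ≟ w
      ... | yes _ = suc k
      ... | no _  = A.height x

      height-w : height w ≡ suc k
      height-w with w ≟ w
      ... | yes _  = refl
      ... | no w≢w = ⊥-elim (w≢w refl)

      height-old : ∀ {x} → x ≢ w → height x ≡ A.height x
      height-old {x} x≢w with x ≟ w
      ... | yes x≡w = ⊥-elim (x≢w x≡w)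
      ... | no _    = refl

      K⊆R : ∀ {q x} → x ∈ K q → x ∈ R
      K⊆R {q} x∈ with ⟦⟧-elim (K-dec q) x∈
      ... | inj₁ (_ , x∈Q) = All.lookup clique⊆R x∈Q
      ... | inj₂ x∈old     = ∖-⊆ (A.K⊆R x∈old)

      climbs : ∀ {q x} → x ∈ K q → q ≡ p ⊎ ∃ λ y → q ≡ ι y × y ∈ R × height x <ℕ height y
      climbs {q} {x} x∈ with ⟦⟧-elim (K-dec q) x∈
      ... | inj₁ (q≡p , _) = inj₁ q≡p
      ... | inj₂ x∈old with A.climbs x∈old | ∖-≢ (A.K⊆R x∈old)
      ...   | inj₁ q≡ιw | x≢w = inj₂ (w , q≡ιw , w∈R ,
                subst₂ _<ℕ_ (≡-sym (height-old x≢w)) (≡-sym height-w) (s≤s (A.height≤ (A.K⊆R x∈old))))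
      ...   | inj₂ (y , q≡ιy , y∈ , lt) | x≢w = inj₂ (y , q≡ιy , ∖-⊆ y∈ ,
                subst₂ _<ℕ_ (≡-sym (height-old x≢w)) (≡-sym (height-old (∖-≢ y∈))) lt)

      height≤ : ∀ {x} → x ∈ R → height x ≤ suc k
      height≤ {x} x∈R with x ≟ w
      ... | yes _   = ≤-refl
      ... | no x≢w  = m≤n⇒m≤1+n (A.height≤ (∖-intro x∈R x≢w))

      p-unused : ∀ {x} → x ∉ A.K p
      p-unused x∈ with A.climbs x∈
      ... | inj₁ p≡ιw = fresh w∈R (≡-sym p≡ιw)
      ... | inj₂ (y , p≡ιy , y∈ , _) = fresh (∖-⊆ y∈) (≡-sym p≡ιy)

      K-clique : ∀ {q a b} → a ∈ K q → b ∈ K q → a ≢ b → Edge G a b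
      K-clique {q} a∈ b∈ a≢b with ⟦⟧-elim (K-dec q) a∈ | ⟦⟧-elim (K-dec q) b∈
      ... | inj₁ (_ , a∈Q)    | inj₁ (_ , b∈Q) = clique a∈Q b∈Q a≢b
      ... | inj₂ a∈old        | inj₂ b∈old     = A.K-clique a∈old b∈old a≢b
      ... | inj₁ (refl , _)   | inj₂ b∈old     = ⊥-elim (p-unused b∈old)
      ... | inj₂ a∈old        | inj₁ (refl , _) = ⊥-elim (p-unused a∈old)

      lift : ∀ {x y} → Star (Linked A.K) x y → Star (Linked K) x y
      lift = Star.map λ (q , x∈ , y∈) → q , old x∈ , old y∈

      -- w reaches the rest through its partner in the top clique
      to-root : ∀ {x} → x ∈ R → Star (Linked K) x root
      to-root {x} x∈R with x ≟ w
      ... | yes refl = (p , top (here refl) , top (there (here refl))) ◅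
                       lift (A.K-connects (∖-intro (All.lookup clique⊆R (there (here refl))) partner≢w) root∈)
      ... | no x≢w   = lift (A.K-connects (∖-intro x∈R x≢w) root∈)

      K-connects : ∀ {x y} → x ∈ R → y ∈ R → Star (Linked K) x y
      K-connects x∈ y∈ = to-root x∈ ◅◅ Star.reverse linked-sym (to-root y∈)

      in-top : ∀ {a b} → a ∈ˡ Q → b ∈ˡ Q → Linked K a b
      in-top a∈Q b∈Q = p , top a∈Q , top b∈Q

      lift-linked : ∀ {a b} → Linked A.K a b → Linked K a b
      lift-linked (q , a∈ , b∈) = q , old a∈ , old b∈

      -- a triangle through w is in the top clique; the others are old
      K-triangles : ∀ {a b c} → a ∈ R → b ∈ R → c ∈ R → Triangle G a b c →
                    Linked K a b × Linked K b c × Linked K a c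
      K-triangles {a} {b} {c} a∈ b∈ c∈ (ab , bc , ac) with a ≟ w | b ≟ w | c ≟ w
      ... | yes refl | _ | _ =
        let (b∈Q , c∈Q) = covers (b∈ , c∈ , ab , bc , ac)
        in in-top (here refl) b∈Q , in-top b∈Q c∈Q , in-top (here refl) c∈Q
      ... | no _ | yes refl | _ =
        let (a∈Q , c∈Q) = covers (a∈ , c∈ , edge-sym ab , ac , bc)
        in in-top a∈Q (here refl) , in-top (here refl) c∈Q , in-top a∈Q c∈Q
      ... | no _ | no _ | yes refl =
        let (a∈Q , b∈Q) = covers (a∈ , b∈ , edge-sym ac , ab , edge-sym bc)
        in in-top a∈Q b∈Q , in-top b∈Q (here refl) , in-top a∈Q (here refl)
      ... | no a≢w | no b≢w | no c≢w =
        let (l-ab , l-bc , l-ac) = A.K-triangles (∖-intro a∈ a≢w) (∖-intro b∈ b≢w) (∖-intro c∈ c≢w) (ab , bc , ac)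
        in lift-linked l-ab , lift-linked l-bc , lift-linked l-ac

    assign : ∀ k {R ρ p} → ρ ∈ R → ConnectedAt R ρ → size R ≤ suc k →
      (∀ {y} → y ∈ R → ι y ≢ p) → Assignment R p k
    assign k {R} {ρ} ρ∈R conn small fresh with any? (λ x → x ∈? R ×-dec ¬? (x ≟ ρ))
    ... | no only-ρ =
      assign-single λ {x} x∈R → decidable-stable (x ≟ ρ) λ x≢ρ → only-ρ (x , x∈R , x≢ρ)
    assign zero ρ∈R conn small fresh | yes (x , x∈R , x≢ρ)
      with ≤-trans (two-members x∈R ρ∈R x≢ρ) small
    ... | s≤s ()
    assign (suc k) {R} ρ∈R conn small fresh | yes (x , x∈R , x≢ρ) =
      assign-peel fresh pl (assign k root∈ remains (≤-pred (≤-trans (size-∖ w∈R) small)) fresh-w)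
      where
      pl : Peel R
      pl = peelable ρ∈R conn x∈R x≢ρ
      open Peel pl
      fresh-w : ∀ {y} → y ∈ R ∖ w → ι y ≢ ι w
      fresh-w y∈ ιy≡ιw = ∖-≢ y∈ (↑ˡ-injective 1 _ _ ιy≡ιw)

path-snoc : ∀ {m} {D : Digraph m} {x y z} → DPath D x y → Arc D y z → DPath D x z
path-snoc (one a)    b = more a (one b)
path-snoc (more a p) b = more a (path-snoc p b)

climbing⇒acyclic : ∀ {m} (D : Digraph m) (h : Fin m → ℕ) → (∀ {x y} → Arc D x y → h x <ℕ h y) →
  Acyclic D
climbing⇒acyclic D h climbs x cycle = <-irrefl refl (along cycle)
  where
  along : ∀ {x y} → DPath D x y → h x <ℕ h y
  along (one a)    = climbs a
  along (more a p) = <-trans (climbs a) (along p)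

-- A nonempty acyclic digraph has a vertex without out-arcs: otherwise
-- following out-arcs from x₀ for m steps revisits a vertex (pigeonhole).
sink-exists : ∀ {m} (D : Digraph m) → Acyclic D → Fin m → ∃ λ s → ∀ y → ¬ Arc D s y
sink-exists {m} D acyclic x₀ with any? (λ s → all? λ y → ¬? (D s y Bool.≟ true))
... | yes sink   = sink
... | no no-sink = ⊥-elim (acyclic _ (proj₂ cycle))
  where
  successor : ∀ s → ∃ λ y → Arc D s y
  successor s = decidable-stable (any? λ y → D s y Bool.≟ true) λ none → no-sink (s , λ y a → none (y , a))
  walk : ℕ → Fin m
  walk zero    = x₀
  walk (suc k) = proj₁ (successor (walk k))
  path : ∀ {i j} → i <ℕ j → DPath D (walk i) (walk j)
  path {i} {suc j} (s≤s i≤j) with i ℕ.≟ j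
  ... | yes refl = one (proj₂ (successor (walk i)))
  ... | no i≢j   = path-snoc (path (≤∧≢⇒< i≤j i≢j)) (proj₂ (successor (walk j)))
  cycle : ∃ λ x → DPath D x x
  cycle with pigeonhole (n<1+n m) (walk ∘ toℕ)
  ... | i , j , i<j , same = walk (toℕ i) , subst (DPath D (walk (toℕ i))) (≡-sym same) (path i<j)

-- Competition graphs of sink digraphs.  Vertices of Fin n point to the sinks
-- whose in-set K q contains them; the k added vertices have no out-arcs.
sinkDigraph : ∀ {n k} → (Fin (n + k) → VSet n) → Digraph (n + k)
sinkDigraph {n} K x q with splitAt n x
... | inj₁ a = K q a
... | inj₂ _ = false

ShareSink : ∀ {n m} → (Fin m → VSet n) → Fin n → Fin n → Set
ShareSink K a b = a ≢ b × ∃ λ q → a ∈ K q × b ∈ K q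

ShareSink? : ∀ {n m} (K : Fin m → VSet n) a b → Dec (ShareSink K a b)
ShareSink? K a b = ¬? (a ≟ b) ×-dec any? λ q → a ∈? K q ×-dec b ∈? K q

-- The graph of pairs sharing a sink: the competition graph of sinkDigraph K
-- restricted to the old vertices.
shareSinkGraph : ∀ {n m} → (Fin m → VSet n) → Graph n
shareSinkGraph K = record
  { adj    = λ a b → does (ShareSink? K a b)
  ; sym    = λ a b → does-⇔ (ShareSink? K a b) (ShareSink? K b a) flip-share flip-share
  ; irrefl = λ a → dec-false (ShareSink? K a a) λ (a≢a , _) → a≢a refl
  }
  where
  flip-share : ∀ {a b} → ShareSink K a b → ShareSink K b a
  flip-share (a≢b , q , a∈ , b∈) = (≢-sym a≢b) , q , b∈ , a∈

shareSink⁺ : ∀ {n m} {K : Fin m → VSet n} {a b} → ShareSink K a b → Edge (shareSinkGraph K) a b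
shareSink⁺ {K = K} {a} {b} = dec-true (ShareSink? K a b)

shareSink⁻ : ∀ {n m} {K : Fin m → VSet n} {a b} → Edge (shareSinkGraph K) a b → ShareSink K a b
shareSink⁻ {K = K} {a} {b} = does-sound (ShareSink? K a b)

shareSink-competition : ∀ {n k} (K : Fin (n + k) → VSet n) →
  IsCompetitionGraph (sinkDigraph K) (addIsolated (shareSinkGraph K) k)
shareSink-competition {n} {k} K x y x≢y with splitAt n x in split-x | splitAt n y in split-y
... | inj₁ a | inj₁ b = mk⇔
  (λ e → let (_ , q , a∈ , b∈) = shareSink⁻ e in q , holds a∈ , holds b∈)
  (λ (q , a→q , b→q) → shareSink⁺ (a≢b , q , mem a→q , mem b→q))
  where
  a≢b : a ≢ b
  a≢b refl = x≢y (trans (≡-sym (splitAt⁻¹-↑ˡ split-x)) (splitAt⁻¹-↑ˡ split-y))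
... | inj₁ _ | inj₂ _ = mk⇔ (λ ()) λ { (_ , _ , ()) }
... | inj₂ _ | _      = mk⇔ (λ ()) λ { (_ , () , _) }

addIsolated-edge : ∀ {n} k (H : Graph n) {a b} → Edge H a b → Edge (addIsolated H k) (a ↑ˡ k) (b ↑ˡ k)
addIsolated-edge {n} k H {a} {b} e rewrite splitAt-↑ˡ n a k | splitAt-↑ˡ n b k = e

-- The sink of an acyclic digraph is isolated in its competition graph, so a
-- graph without isolated vertices has competition number at least 1.
no-isolated⇒¬CompRep0 : ∀ {n} (H : Graph n) → Fin n → (∀ x → ∃ λ y → Edge H x y) → ¬ CompRep H 0
no-isolated⇒¬CompRep0 {n} H v nonisolated (D , acyclic , competition)
  with sink-exists D acyclic (v ↑ˡ 0)
... | s , no-out with splitAt n s in split-s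
... | inj₂ ()
... | inj₁ a with nonisolated a
... | b , ab rewrite ≡-sym (splitAt⁻¹-↑ˡ split-s) =
  let (q , a→q , _) = Equivalence.to (competition (a ↑ˡ 0) (b ↑ˡ 0) a≢b) (addIsolated-edge 0 H ab)
  in no-out q a→q
  where
  a≢b : a ↑ˡ 0 ≢ b ↑ˡ 0
  a≢b same = edge-≢ H ab (↑ˡ-injective 0 a b same)

walk-first-edge : ∀ {n} {H : Graph n} {x y} → Walk H x y → x ≢ y → ∃ λ z → Edge H x z
walk-first-edge stay       x≢x = ⊥-elim (x≢x refl)
walk-first-edge (step e _) _   = _ , e

connected⇒no-isolated : ∀ {n} (H : Graph n) → 2 ≤ n → Connected H → ∀ x → ∃ λ y → Edge H x y
connected⇒no-isolated H (s≤s (s≤s _)) connected x with x ≟ zero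
... | yes x≡0 = walk-first-edge (connected x (suc zero)) λ x≡1 → contradiction (trans (≡-sym x≡0) x≡1) λ ()
... | no x≢0  = walk-first-edge (connected x zero) x≢0

-- The construction for a connected graph G with at most three triangles,
-- rooted at a vertex ρ: peel all of G with the added vertex as top sink.
module Construction {n} (G : Graph n) (few : numTriangles G ≤ 3) (connected : Connected G) (ρ : Fin n) where

  everything : VSet n
  everything _ = true

  top : Sink G few
  top = n ↑ʳ 0F

  old≢top : ∀ {y} → ι G few y ≢ top
  old≢top {y} same with trans (≡-sym (splitAt-↑ˡ n y 1)) (trans (cong (splitAt n) same) (splitAt-↑ʳ n 1 0F))
  ... | ()

  walk-everywhere : ∀ {x y} → Walk G x y → WalkIn G everything x y
  walk-everywhere stay       = stayIn (mem refl)
  walk-everywhere (step e w) = stepIn (mem refl) e (walk-everywhere w)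

  assignment : Assignment G few everything top n
  assignment = assign G few n (mem refl) (λ x _ → walk-everywhere (connected x ρ))
    (m≤n⇒m≤1+n (size-≤ everything)) λ _ → old≢top
  open Assignment assignment

  G' : Graph n
  G' = shareSinkGraph K

  edge⁺ : ∀ {a b} → ShareSink K a b → Edge G' a b
  edge⁺ = shareSink⁺ {K = K}

  spanning : SpanningSubgraph G' G
  spanning a b e = let (a≢b , _ , a∈ , b∈) = shareSink⁻ {K = K} e in K-clique a∈ b∈ a≢b

  linked⇒walk : ∀ {x y} → Star (Linked G few K) x y → Walk G' x y
  linked⇒walk ε = stay
  linked⇒walk {x} (_◅_ {j = y} (q , x∈ , y∈) rest) with x ≟ y
  ... | yes refl = linked⇒walk rest
  ... | no x≢y   = step (edge⁺ (x≢y , q , x∈ , y∈)) (linked⇒walk rest)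

  connected' : Connected G'
  connected' x y = linked⇒walk (K-connects (mem refl) (mem refl))

  keeps-triangles : ContainsTrianglesOf G' G
  keeps-triangles a b c (ab , bc , ac) =
    let ((_ , ab-in) , (_ , bc-in) , (_ , ac-in)) = K-triangles (mem refl) (mem refl) (mem refl) (ab , bc , ac)
    in edge⁺ (edge-≢ G ab , _ , ab-in) , edge⁺ (edge-≢ G bc , _ , bc-in) ,
       edge⁺ (edge-≢ G ac , _ , ac-in)

  level : Fin (n + 1) → ℕ
  level x with splitAt n x
  ... | inj₁ a = height a
  ... | inj₂ _ = suc n

  level-top : level top ≡ suc n
  level-top rewrite splitAt-↑ʳ n 1 0F = refl

  level-old : ∀ y → level (ι G few y) ≡ height y
  level-old y rewrite splitAt-↑ˡ n y 1 = refl

  arcs-climb : ∀ {x q} → Arc (sinkDigraph K) x q → level x <ℕ level q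
  arcs-climb {x} {q} arc with splitAt n x
  ... | inj₁ a with climbs (mem arc)
  ...   | inj₁ refl = subst (height a <ℕ_) (≡-sym level-top) (s≤s (height≤ (mem refl)))
  ...   | inj₂ (y , refl , _ , lower) = subst (height a <ℕ_) (≡-sym (level-old y)) lower

  representation : CompRep G' 1
  representation = sinkDigraph K , climbing⇒acyclic (sinkDigraph K) level arcs-climb , shareSink-competition K

mainTheorem7 : ∀ {n : ℕ} (G : Graph n) → 2 ≤ n → Connected G → numTriangles G ≤ 3 →
    Σ (Graph n) λ G' → SpanningSubgraph G' G × Connected G' ×
    ContainsTrianglesOf G' G × CompetitionNumber G' 1
mainTheorem7 G two@(s≤s _) connected few =
  G' , spanning , connected' , keeps-triangles , representation , not-less
  where
  open Construction G few connected zero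
  -- G' has no isolated vertex, so it needs at least one added vertex.
  not-less : ∀ j → j <ℕ 1 → ¬ CompRep G' j
  not-less zero    _         = no-isolated⇒¬CompRep0 G' zero (connected⇒no-isolated G' two connected')
  not-less (suc j) (s≤s ())
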